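{- Let $h\geq 4$ be an integer. Let $A=\{0,a_2,\ldots,a_{h+1}\}$ be a set of nonnegative integers such that $0<a_2<\cdots<a_{h+1}$. Assume that $a_2\not\equiv 0\pmod 2$, $a_3=2a_2$, $a_4\not\equiv 0\pmod 2$ and $a_4\neq 3a_2$. Then \[ |h^{\wedge}_{\pm}A| \geq \begin{cases} h^2+h+2, & \text{if } 3a_2<a_4;\\ h^2+2h-2, & \text{if } a_4<3a_2.\end{cases} \] Hence $|h^{\wedge}_{\pm}A|\geq h^2+h+2$.
   Context: For a finite set $A=\{a_1,\ldots,a_k\}$ of integers and a positive integer $h$, the restricted $h$-fold signed sumset is $h^{\wedge}_{\pm}A=\left\{\sum_{i=1}^{k}\lambda_i a_i : \lambda_i\in\{ -1,0,1\} \text{ for all } i,\ \sum_{i=1}^{k}|\lambda_i| = h\right\}$. -}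

module Defs where

open import Data.Nat as ℕ using (ℕ; zero; suc)
open import Data.Integer as ℤ using (ℤ)
open import Data.Fin using (Fin; toℕ)
open import Data.Vec using (Vec; []; _∷_)
open import Data.List using (List; []; _∷_; map; filter; concatMap; length; deduplicate)
open import Relation.Nullary.Decidable using (_because_)
open import Relation.Binary.PropositionalEquality using (_≡_)

data Sign : Set where
  neg zer pos : Sign

signVal : Sign → ℤ
signVal neg = ℤ.-1ℤ
signVal zer = ℤ.0ℤ
signVal pos = ℤ.1ℤ

absSign : Sign → ℕ
absSign zer = 0
absSign _   = 1

allSigns : (n : ℕ) → List (Vec Sign n)
allSigns zero = [] ∷ []
allSigns (suc n) =
  concatMap (λ v → (neg ∷ v) ∷ (zer ∷ v) ∷ (pos ∷ v) ∷ []) (allSigns n)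

weight : ∀ {n} → Vec Sign n → ℕ
weight [] = 0
weight (s ∷ v) = absSign s ℕ.+ weight v

signedSum : ∀ {n} → Vec Sign n → Vec ℤ n → ℤ
signedSum [] [] = ℤ.0ℤ
signedSum (s ∷ v) (x ∷ xs) = signVal s ℤ.* x ℤ.+ signedSum v xs

-- The restricted h-fold signed sumset h^∧_± A of A = {a₁,…,aₙ},
-- as a list (possibly with repetitions) of all its elements.
restrictedSignedSumset : ∀ {n} → ℕ → Vec ℤ n → List ℤ
restrictedSignedSumset {n} h as =
  map (λ v → signedSum v as)
      (filter (λ v → weight v ℕ.≟ h) (allSigns n))

card : List ℤ → ℕ
card xs = length (deduplicate ℤ._≟_ xs)

restrictedSignedSumsetSize : ∀ {n} → ℕ → Vec ℤ n → ℕ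
restrictedSignedSumsetSize h as = card (restrictedSignedSumset h as)

-- Write A = {0, a₂, 2a₂, a₄} ∪ {c₁ < ⋯ < c_m} with m = h - 3 and count only sums in which every
-- cᵢ has a nonzero coefficient, so that exactly one of 0, a₂, 2a₂, a₄ is omitted. Since a₂ and a₄
-- are odd, omitting 0 or 2a₂ gives sums of the parity of c₁ + ⋯ + c_m and omitting a₂ or a₄ sums
-- of the other parity, so the two families can be counted separately.
-- In a family let T be the largest head sum and k the number of head sums ≥ T - 2a₄. Adding the
-- cⱼ in increasing order, the values already found for c₁, …, c_{j-1}, shifted by -cⱼ, stay below
-- k + (j - 1) new ones: the k near-top head sums with all signs of the tail positive, and T with
-- the sign of a single earlier cᵢ flipped. Starting from all head sums of the family this gives
-- (number of head sums) + m k + (m choose 2) distinct values. For a₄ > 3a₂ the two families have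
-- 8 and 6 head sums with k = 4 and 4, for a₄ < 3a₂ they have 8 and 8 with k = 4 and 5, giving
-- h² + h + 2 and (h + 1)² elements respectively.

module Submission where

open import Defs
open import Data.Nat as ℕ using (ℕ; suc; _∸_)
open import Data.Integer as ℤ using (ℤ)
open import Data.Integer.Divisibility using (_∣_)
open import Data.Vec using (Vec; _∷_)
open import Data.Vec.Relation.Unary.Linked using (Linked)
open import Data.Product using (_×_)
open import Relation.Binary.PropositionalEquality using (_≡_; _≢_)
open import Relation.Nullary using (¬_)

open import Data.Empty using (⊥-elim)
open import Data.Integer using (0ℤ; 1ℤ; _+_; _-_; _*_; -_; _<_; _≤_; _>_)
open import Data.Integer.Divisibility.Signed as Signed using (divides)
open import Data.Integer.DivMod using (n%d<d; a≡a%n+[a/n]*n)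
import Data.Integer.Properties as ℤ
open import Data.Integer.Tactic.RingSolver using (solve-∀; solve)
open import Data.List as List using (List; []; _∷_; length; map)
open import Data.List.Membership.Propositional using (_∈_)
open import Data.List.Membership.Propositional.Properties
  using (∈-concatMap⁺; ∈-filter⁺; ∈-map⁺; ∈-deduplicate⁺)
open import Data.List.Properties using (length-removeAt′; length-++; length-map; take-map)
open import Data.List.Relation.Binary.Subset.Propositional using (_⊆_)
open import Data.List.Relation.Unary.All as All using (All; []; _∷_)
import Data.List.Relation.Unary.All.Properties as All
open import Data.List.Relation.Unary.AllPairs as AllPairs using (AllPairs; []; _∷_)
import Data.List.Relation.Unary.AllPairs.Properties as AllPairs
open import Data.List.Relation.Unary.Any as Any using (here; there)
import Data.List.Relation.Unary.Linked as ListLinked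
import Data.List.Relation.Unary.Linked.Properties as ListLinked
open import Data.List.Relation.Unary.Unique.Propositional using (Unique)
open import Data.Nat using (z≤n; s≤s)
open import Data.Nat.Combinatorics using (_C_; nC1≡n; nCk+nC[k+1]≡[n+1]C[k+1])
import Data.Nat.Properties as ℕ
import Data.Nat.Tactic.RingSolver as ℕ-Solver
open import Data.Product using (Σ-syntax; _,_; proj₁; proj₂)
open import Data.Sum using (_⊎_; inj₁; inj₂)
open import Data.Vec using ([]; _∷ʳ_; _++_; toList; initLast)
open import Data.Vec.Properties using (length-toList)
open import Data.Vec.Relation.Unary.Linked using ([-]; _∷_)
open import Function using (_∘_)
open import Relation.Binary.Definitions using (tri<; tri≈; tri>)
open import Relation.Binary.PropositionalEquality
  using (refl; sym; trans; cong; cong₂; subst; subst₂; ≢-sym; module ≡-Reasoning)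
open import Relation.Nullary using (Dec; ¬?; _×-dec_; _⊎-dec_)
open import Relation.Nullary.Decidable using (from-yes)

∈-─⁺ : ∀ {A : Set} {x y : A} {ys} (x∈ys : x ∈ ys) → y ∈ ys → y ≢ x → y ∈ (ys Any.─ x∈ys)
∈-─⁺ (here refl)  (here refl)  y≢x = ⊥-elim (y≢x refl)
∈-─⁺ (here _)     (there y∈ys) _   = y∈ys
∈-─⁺ (there _)    (here y≡z)   _   = here y≡z
∈-─⁺ (there x∈ys) (there y∈ys) y≢x = there (∈-─⁺ x∈ys y∈ys y≢x)

Unique⇒length-≤ : ∀ {A : Set} {xs ys : List A} → Unique xs → xs ⊆ ys → length xs ℕ.≤ length ys
Unique⇒length-≤ []                    _        = z≤n
Unique⇒length-≤ {ys = ys} (x∉xs ∷ xs!) x∷xs⊆ys =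
  ℕ.≤-trans (s≤s (Unique⇒length-≤ xs! xs⊆ys─x)) (ℕ.≤-reflexive (sym (length-removeAt′ ys _)))
  where
  x∈ys : _ ∈ ys
  x∈ys = x∷xs⊆ys (here refl)
  xs⊆ys─x : _ ⊆ (ys Any.─ x∈ys)
  xs⊆ys─x y∈xs = ∈-─⁺ x∈ys (x∷xs⊆ys (there y∈xs)) (λ y≡x → All.lookup x∉xs y∈xs (sym y≡x))

∈-allSigns : ∀ {n} (v : Vec Sign n) → v ∈ allSigns n
∈-allSigns []      = here refl
∈-allSigns (s ∷ v) = ∈-concatMap⁺ _ (Any.map (λ { refl → ∈-extensions s }) (∈-allSigns v))
  where
  ∈-extensions : ∀ {n} {v : Vec Sign n} s → (s ∷ v) ∈ (neg ∷ v) ∷ (zer ∷ v) ∷ (pos ∷ v) ∷ []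
  ∈-extensions neg = here refl
  ∈-extensions zer = there (here refl)
  ∈-extensions pos = there (there (here refl))

∈-restrictedSignedSumset : ∀ {n h} {as : Vec ℤ n} (v : Vec Sign n) → weight v ≡ h →
                           signedSum v as ∈ restrictedSignedSumset h as
∈-restrictedSignedSumset {h = h} {as} v weight≡h =
  ∈-map⁺ (λ w → signedSum w as) (∈-filter⁺ (λ w → weight w ℕ.≟ h) (∈-allSigns v) weight≡h)

Unique⇒length≤sumsetSize : ∀ {n h} {as : Vec ℤ n} {xs : List ℤ} → Unique xs →
                           All (_∈ restrictedSignedSumset h as) xs →
                           length xs ℕ.≤ restrictedSignedSumsetSize h as
Unique⇒length≤sumsetSize xs! xs⊆ = Unique⇒length-≤ xs! (∈-deduplicate⁺ ℤ._≟_ ∘ All.lookup xs⊆)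

weight-++ : ∀ {m n} (u : Vec Sign m) (v : Vec Sign n) → weight (u ++ v) ≡ weight u ℕ.+ weight v
weight-++ []      v = refl
weight-++ (s ∷ u) v = trans (cong (absSign s ℕ.+_) (weight-++ u v)) (sym (ℕ.+-assoc (absSign s) _ _))

signedSum-++ : ∀ {m n} (u : Vec Sign m) (v : Vec Sign n) (as : Vec ℤ m) (bs : Vec ℤ n) →
               signedSum (u ++ v) (as ++ bs) ≡ signedSum u as + signedSum v bs
signedSum-++ []      v []       bs = sym (ℤ.+-identityˡ _)
signedSum-++ (s ∷ u) v (a ∷ as) bs =
  trans (cong (signVal s * a +_) (signedSum-++ u v as bs)) (sym (ℤ.+-assoc (signVal s * a) _ _))

Even : ℤ → Set
Even x = Signed._∣_ (ℤ.+ 2) x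

even-double : ∀ x → Even (x + x)
even-double x = divides x (solve (x List.∷ List.[]))

odd⇒pred-even : ∀ a → ¬ Even a → Even (a - 1ℤ)
odd⇒pred-even a a-odd with a ℤ.% ℤ.+ 2 | n%d<d a (ℤ.+ 2) | a≡a%n+[a/n]*n a (ℤ.+ 2)
... | 0           | _            | a≡ = ⊥-elim (a-odd (divides (a ℤ./ ℤ.+ 2) (trans a≡ (ℤ.+-identityˡ _))))
... | 1           | _            | a≡ = divides (a ℤ./ ℤ.+ 2) (trans (cong (_- 1ℤ) a≡) (cancel (a ℤ./ ℤ.+ 2)))
  where
  cancel : ∀ q → (1ℤ + q * ℤ.+ 2) - 1ℤ ≡ q * ℤ.+ 2
  cancel = solve-∀
... | suc (suc _) | s≤s (s≤s ()) | _

data Parity : Set where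
  even odd : Parity

HasParity : Parity → ℤ → Set
HasParity even x = Even x
HasParity odd  x = ¬ Even x

hasParity? : ∀ π x → Dec (HasParity π x)
hasParity? even x = ℤ.+ 2 Signed.∣? x
hasParity? odd  x = ¬? (ℤ.+ 2 Signed.∣? x)

combination-parity : ∀ {a d} → Even (a - 1ℤ) → Even (d - 1ℤ) →
                     ∀ π α β → HasParity π (α + β) → HasParity π (α * a + β * d)
combination-parity {a} {d} a-odd d-odd π α β = transport π
  where
  δ-even : Even (α * (a - 1ℤ) + β * (d - 1ℤ))
  δ-even = Signed.∣m∣n⇒∣m+n (Signed.∣n⇒∣m*n α a-odd) (Signed.∣n⇒∣m*n β d-odd)
  split : α * a + β * d ≡ (α + β) + (α * (a - 1ℤ) + β * (d - 1ℤ))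
  split = solve (α List.∷ β List.∷ a List.∷ d List.∷ List.[])
  transport : ∀ π → HasParity π (α + β) → HasParity π (α * a + β * d)
  transport even s-even = subst Even (sym split) (Signed.∣m∣n⇒∣m+n s-even δ-even)
  transport odd  s-odd  = λ v-even → s-odd (Signed.∣m+n∣n⇒∣m (subst Even split v-even) δ-even)

total : ∀ {n} → Vec ℤ n → ℤ
total []       = 0ℤ
total (c ∷ cs) = c + total cs

total-∷ʳ : ∀ {n} (cs : Vec ℤ n) c → total (cs ∷ʳ c) ≡ total cs + c
total-∷ʳ []        c = ℤ.+-comm c 0ℤ
total-∷ʳ (c′ ∷ cs) c = trans (cong (c′ +_) (total-∷ʳ cs c)) (sym (ℤ.+-assoc c′ (total cs) c))

data FullSignedSum : ∀ {n} → Vec ℤ n → ℤ → Set where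
  []    : FullSignedSum [] 0ℤ
  plus  : ∀ {n c t} {cs : Vec ℤ n} → FullSignedSum cs t → FullSignedSum (c ∷ cs) (c + t)
  minus : ∀ {n c t} {cs : Vec ℤ n} → FullSignedSum cs t → FullSignedSum (c ∷ cs) (- c + t)

fullSigned-total : ∀ {n} (cs : Vec ℤ n) → FullSignedSum cs (total cs)
fullSigned-total []       = []
fullSigned-total (c ∷ cs) = plus (fullSigned-total cs)

fullSigned-∷ʳ : ∀ {n} {cs : Vec ℤ n} {t} c → FullSignedSum cs t →
                FullSignedSum (cs ∷ʳ c) (t + c) × FullSignedSum (cs ∷ʳ c) (t - c)
fullSigned-∷ʳ c [] = subst (FullSignedSum _) (ℤ.+-comm c 0ℤ) (plus []) ,
                     subst (FullSignedSum _) (ℤ.+-comm (- c) 0ℤ) (minus [])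
fullSigned-∷ʳ c (plus {c = c′} {t} t∈) =
  let t+c , t-c = fullSigned-∷ʳ c t∈ in
  subst (FullSignedSum _) (sym (ℤ.+-assoc c′ t c)) (plus t+c) ,
  subst (FullSignedSum _) (sym (ℤ.+-assoc c′ t (- c))) (plus t-c)
fullSigned-∷ʳ c (minus {c = c′} {t} t∈) =
  let t+c , t-c = fullSigned-∷ʳ c t∈ in
  subst (FullSignedSum _) (sym (ℤ.+-assoc (- c′) t c)) (minus t+c) ,
  subst (FullSignedSum _) (sym (ℤ.+-assoc (- c′) t (- c))) (minus t-c)

fullSigned-flip : ∀ {n} {cs : Vec ℤ n} {x} → x ∈ toList cs → FullSignedSum cs (total cs - (x + x))
fullSigned-flip {cs = c ∷ cs} (here refl) =
  subst (FullSignedSum _) (flip c (total cs)) (minus (fullSigned-total cs))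
  where
  flip : ∀ c s → - c + s ≡ (c + s) - (c + c)
  flip = solve-∀
fullSigned-flip {cs = c ∷ cs} {x} (there x∈cs) =
  subst (FullSignedSum _) (sym (ℤ.+-assoc c (total cs) (- (x + x)))) (plus (fullSigned-flip x∈cs))

fullSigned-parity : ∀ {n} {cs : Vec ℤ n} {t} → FullSignedSum cs t → Even (total cs - t)
fullSigned-parity [] = divides 0ℤ refl
fullSigned-parity {cs = c ∷ cs} (plus {t = t} t∈) =
  subst Even (cancel c (total cs) t) (fullSigned-parity t∈)
  where
  cancel : ∀ c s t → s - t ≡ (c + s) - (c + t)
  cancel = solve-∀
fullSigned-parity {cs = c ∷ cs} (minus {t = t} t∈) =
  subst Even (flip c (total cs) t) (Signed.∣m∣n⇒∣m+n (even-double c) (fullSigned-parity t∈))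
  where
  flip : ∀ c s t → (c + c) + (s - t) ≡ (c + s) - (- c + t)
  flip = solve-∀

fullSigned⇒signedSum : ∀ {n} {cs : Vec ℤ n} {t} → FullSignedSum cs t →
                       Σ[ v ∈ Vec Sign n ] weight v ≡ n × signedSum v cs ≡ t
fullSigned⇒signedSum [] = [] , refl , refl
fullSigned⇒signedSum (plus {c = c} t∈) =
  let v , weight≡n , v·cs≡t = fullSigned⇒signedSum t∈ in
  pos ∷ v , cong suc weight≡n , cong₂ _+_ (ℤ.*-identityˡ c) v·cs≡t
fullSigned⇒signedSum (minus {c = c} t∈) =
  let v , weight≡n , v·cs≡t = fullSigned⇒signedSum t∈ in
  neg ∷ v , cong suc weight≡n , cong₂ _+_ (ℤ.-1*i≡-i c) v·cs≡t

module _ {A : Set} {R : A → A → Set} (R-trans : ∀ {x y z} → R x y → R y z → R x z) where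

  Linked⇒AllPairs-toList : ∀ {n} {xs : Vec A n} → Linked R xs → AllPairs R (toList xs)
  Linked⇒AllPairs-toList Linked.[] = []
  Linked⇒AllPairs-toList [-]       = [] ∷ []
  Linked⇒AllPairs-toList {xs = _ ∷ _ ∷ _} (r ∷ rs) with Linked⇒AllPairs-toList rs
  ... | r′s ∷ sorted = (r ∷ All.map (R-trans r) r′s) ∷ r′s ∷ sorted

  Linked-∷ʳ⁻ : ∀ {n} x (ys : Vec A n) y → Linked R (x ∷ (ys ∷ʳ y)) →
               Linked R (x ∷ ys) × All (λ z → R z y) (x ∷ toList ys)
  Linked-∷ʳ⁻ x []       y (r ∷ [-]) = [-] , r ∷ []
  Linked-∷ʳ⁻ x (z ∷ ys) y (r ∷ rs) =
    let rs′ , below = Linked-∷ʳ⁻ z ys y rs in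
    r ∷ rs′ , R-trans r (All.head below) ∷ below

minus-double-< : ∀ k {x y} → x < y → k - (y + y) < k - (x + x)
minus-double-< k x<y = ℤ.+-monoʳ-< k (ℤ.neg-mono-< (ℤ.+-mono-< x<y x<y))

minus-double-≤ : ∀ k {y} → 0ℤ ≤ y → k - (y + y) ≤ k
minus-double-≤ k 0≤y =
  ℤ.≤-trans (ℤ.+-monoʳ-≤ k (ℤ.neg-mono-≤ (ℤ.+-mono-≤ 0≤y 0≤y))) (ℤ.≤-reflexive (ℤ.+-identityʳ k))

[1+m]C2≡m+mC2 : ∀ m → suc m C 2 ≡ m ℕ.+ m C 2
[1+m]C2≡m+mC2 m = trans (sym (nCk+nC[k+1]≡[n+1]C[k+1] m 1)) (cong (ℕ._+ m C 2) (nC1≡n m))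

record Distinct (P : ℤ → Set) (size : ℕ) : Set where
  field
    values     : List ℤ
    descending : AllPairs _>_ values
    satisfy    : All P values
    length≡    : length values ≡ size

Distinct-weaken : ∀ {P Q : ℤ → Set} {n} → (∀ {x} → P x → Q x) → Distinct P n → Distinct Q n
Distinct-weaken P⇒Q D = record { Distinct D; satisfy = All.map P⇒Q (Distinct.satisfy D) }

Distinct-++ : ∀ {P Q : ℤ → Set} {n₁ n₂} → (∀ {x y} → P x → Q y → x > y) →
              Distinct P n₁ → Distinct Q n₂ → Distinct (λ z → P z ⊎ Q z) (n₁ ℕ.+ n₂)
Distinct-++ P>Q D₁ D₂ = record
  { values     = D₁.values List.++ D₂.values
  ; descending = AllPairs.++⁺ D₁.descending D₂.descending
                   (All.map (λ px → All.map (P>Q px) D₂.satisfy) D₁.satisfy)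
  ; satisfy    = All.++⁺ (All.map inj₁ D₁.satisfy) (All.map inj₂ D₂.satisfy)
  ; length≡    = trans (length-++ D₁.values) (cong₂ ℕ._+_ D₁.length≡ D₂.length≡)
  }
  where
  module D₁ = Distinct D₁
  module D₂ = Distinct D₂

Reachable : (ℤ → Set) → ∀ {n} → Vec ℤ n → ℤ → Set
Reachable Good cs y = Σ[ x ∈ ℤ ] Σ[ t ∈ ℤ ] Good x × FullSignedSum cs t × y ≡ x + t

module TailExtension (Good : ℤ → Set) {b : ℤ} (0≤b : 0ℤ ≤ b)
                     {T : ℤ} {heads : List ℤ} (T∷heads↓ : AllPairs _>_ (T ∷ heads))
                     (good : All Good (T ∷ heads))
                     (k : ℕ) (near-top : All (T - (b + b) ≤_) (List.take k (T ∷ heads))) where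

  Q : List ℤ
  Q = List.take k (T ∷ heads)

  ≤-top : All (_≤ T) (T ∷ heads)
  ≤-top = ℤ.≤-refl ∷ All.map ℤ.<⇒≤ (AllPairs.head T∷heads↓)

  Chain : ∀ {m} → Vec ℤ m → ℕ → Set
  Chain cs = Distinct (λ y → Reachable Good cs y × y ≤ T + total cs)

  start : Chain [] (length (T ∷ heads))
  start = record
    { values     = T ∷ heads
    ; descending = T∷heads↓
    ; satisfy    = All.zip (All.map (λ {x} gx → x , 0ℤ , gx , [] , sym (ℤ.+-identityʳ x)) good ,
                            All.map (λ x≤T → ℤ.≤-trans x≤T (ℤ.≤-reflexive (sym (ℤ.+-identityʳ T)))) ≤-top)
    ; length≡    = refl
    }

  module Step {m len} {ys : Vec ℤ m} {c} (linked : Linked _<_ (b ∷ (ys ∷ʳ c))) (previous : Chain ys len) where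
    S S′ top θ₁ θ₂ : ℤ
    S   = total ys
    S′  = total (ys ∷ʳ c)
    top = T + S′
    θ₁  = top - (b + b)
    θ₂  = top - (c + c)

    S′≡ : S′ ≡ S + c
    S′≡ = total-∷ʳ ys c

    split : Linked _<_ (b ∷ ys) × All (_< c) (b ∷ toList ys)
    split = Linked-∷ʳ⁻ ℤ.<-trans b ys c linked
    b∷ys↑ : AllPairs _<_ (b ∷ toList ys)
    b∷ys↑ = Linked⇒AllPairs-toList ℤ.<-trans (proj₁ split)
    b<c : b < c
    b<c = All.head (proj₂ split)

    New : (ℤ → Set) → ℤ → Set
    New Window y = Reachable Good (ys ∷ʳ c) y × Window y

    nearTops : Distinct (New (λ y → θ₁ ≤ y × y ≤ top)) (length Q)
    nearTops = record
      { values     = map (_+ S′) Q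
      ; descending = AllPairs.map⁺ (AllPairs.map (ℤ.+-monoˡ-< S′) (AllPairs.take⁺ k T∷heads↓))
      ; satisfy    = All.map⁺ (All.zipWith block (All.take⁺ k good , All.zip (near-top , All.take⁺ k ≤-top)))
      ; length≡    = length-map _ Q
      }
      where
      regroup : ∀ T S b → (T - (b + b)) + S ≡ (T + S) - (b + b)
      regroup = solve-∀
      block : ∀ {q} → Good q × T - (b + b) ≤ q × q ≤ T → New (λ y → θ₁ ≤ y × y ≤ top) (q + S′)
      block {q} (gq , ≤q , q≤) =
        (q , S′ , gq , fullSigned-total _ , refl) ,
        subst (_≤ q + S′) (regroup T S′ b) (ℤ.+-monoˡ-≤ S′ ≤q) , ℤ.+-monoˡ-≤ S′ q≤

    flips : Distinct (New (λ y → θ₂ < y × y < θ₁)) m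
    flips = record
      { values     = map (λ y → top - (y + y)) (toList ys)
      ; descending = AllPairs.map⁺ (AllPairs.map (minus-double-< top) (AllPairs.tail b∷ys↑))
      ; satisfy    = All.map⁺ (All.tabulate block)
      ; length≡    = trans (length-map _ (toList ys)) (length-toList ys)
      }
      where
      regroup : ∀ T S c y → (T + (S + c)) - (y + y) ≡ T + ((S - (y + y)) + c)
      regroup = solve-∀
      block : ∀ {y} → y ∈ toList ys → New (λ y → θ₂ < y × y < θ₁) (top - (y + y))
      block {y} y∈ys =
        (T , (S - (y + y)) + c , All.head good , proj₁ (fullSigned-∷ʳ c (fullSigned-flip y∈ys)) ,
         trans (cong (λ s → (T + s) - (y + y)) S′≡) (regroup T S c y)) ,
        minus-double-< top (All.lookup (All.tail (proj₂ split)) y∈ys) ,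
        minus-double-< top (All.lookup (AllPairs.head b∷ys↑) y∈ys)

    shifted : Distinct (New (_≤ θ₂)) len
    shifted = record
      { values     = map (_- c) values
      ; descending = AllPairs.map⁺ (AllPairs.map (ℤ.+-monoˡ-< (- c)) descending)
      ; satisfy    = All.map⁺ (All.map block satisfy)
      ; length≡    = trans (length-map _ values) length≡
      }
      where
      open Distinct previous
      regroup : ∀ T S c → (T + S) - c ≡ (T + (S + c)) - (c + c)
      regroup = solve-∀
      block : ∀ {y} → Reachable Good ys y × y ≤ T + S → New (_≤ θ₂) (y - c)
      block ((x , t , gx , t∈ , y≡x+t) , y≤) =
        (x , t - c , gx , proj₂ (fullSigned-∷ʳ c t∈) , trans (cong (_- c) y≡x+t) (ℤ.+-assoc x t (- c))) ,
        ℤ.≤-trans (ℤ.+-monoˡ-≤ (- c) y≤)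
                  (ℤ.≤-reflexive (trans (regroup T S c) (cong (λ s → (T + s) - (c + c)) (sym S′≡))))

    below-top : ∀ {y} → New (λ y → θ₁ ≤ y × y ≤ top) y ⊎ New (λ y → θ₂ < y × y < θ₁) y ⊎ New (_≤ θ₂) y →
                Reachable Good (ys ∷ʳ c) y × y ≤ top
    below-top (inj₁ (r , _ , y≤top))        = r , y≤top
    below-top (inj₂ (inj₁ (r , _ , y<θ₁))) = r , ℤ.<⇒≤ (ℤ.<-≤-trans y<θ₁ (minus-double-≤ top 0≤b))
    below-top (inj₂ (inj₂ (r , y≤θ₂)))      = r , ℤ.≤-trans y≤θ₂ (minus-double-≤ top 0≤c)
      where
      0≤c : 0ℤ ≤ c
      0≤c = ℤ.≤-trans 0≤b (ℤ.<⇒≤ b<c)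

  extend : ∀ {m len} {ys : Vec ℤ m} {c} → Linked _<_ (b ∷ (ys ∷ʳ c)) → Chain ys len →
           Chain (ys ∷ʳ c) (length Q ℕ.+ (m ℕ.+ len))
  extend linked previous =
    Distinct-weaken below-top
      (Distinct-++ (λ { (_ , θ₁≤x , _) (inj₁ (_ , _ , y<θ₁)) → ℤ.<-≤-trans y<θ₁ θ₁≤x
                      ; (_ , θ₁≤x , _) (inj₂ (_ , y≤θ₂))     → ℤ.<-≤-trans (ℤ.≤-<-trans y≤θ₂ θ₂<θ₁) θ₁≤x })
                   nearTops
                   (Distinct-++ (λ { (_ , θ₂<x , _) (_ , y≤θ₂) → ℤ.≤-<-trans y≤θ₂ θ₂<x }) flips shifted))
    where
    open Step linked previous
    θ₂<θ₁ : θ₂ < θ₁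
    θ₂<θ₁ = minus-double-< top b<c

  chain : ∀ {m} (cs : Vec ℤ m) → Linked _<_ (b ∷ cs) →
          Chain cs (length (T ∷ heads) ℕ.+ m ℕ.* length Q ℕ.+ m C 2)
  chain {ℕ.zero} [] _ = subst (Chain []) (sym (trans (ℕ.+-identityʳ _) (ℕ.+-identityʳ _))) start
  chain {suc m} cs linked with initLast cs
  ... | ys , c , refl =
    subst (Chain _) size-suc (extend linked (chain ys (proj₁ (Linked-∷ʳ⁻ ℤ.<-trans b ys c linked))))
    where
    regroup : ∀ B q m X → q ℕ.+ (m ℕ.+ (B ℕ.+ m ℕ.* q ℕ.+ X)) ≡ B ℕ.+ (q ℕ.+ m ℕ.* q) ℕ.+ (m ℕ.+ X)
    regroup = ℕ-Solver.solve-∀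
    size-suc : length Q ℕ.+ (m ℕ.+ (length (T ∷ heads) ℕ.+ m ℕ.* length Q ℕ.+ m C 2)) ≡
               length (T ∷ heads) ℕ.+ suc m ℕ.* length Q ℕ.+ suc m C 2
    size-suc = trans (regroup (length (T ∷ heads)) (length Q) m (m C 2))
                     (cong (length (T ∷ heads) ℕ.+ suc m ℕ.* length Q ℕ.+_) (sym ([1+m]C2≡m+mC2 m)))

i<j⇒0<j-i : ∀ {i j} → i < j → 0ℤ < j - i
i<j⇒0<j-i {i} {j} i<j = subst (_< j - i) (ℤ.+-inverseʳ i) (ℤ.+-monoˡ-< (- i) i<j)

0<i-j⇒j<i : ∀ {i j} → 0ℤ < i - j → j < i
0<i-j⇒j<i {i} {j} 0<i-j = subst₂ _<_ (ℤ.+-identityˡ j) (regroup i j) (ℤ.+-monoˡ-< j 0<i-j)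
  where
  regroup : ∀ i j → i - j + j ≡ i
  regroup = solve-∀

combination : ℤ → ℤ → ℤ × ℤ → ℤ
combination a d (α , β) = α * a + β * d

_⊖_ : ℤ × ℤ → ℤ × ℤ → ℤ × ℤ
(α , β) ⊖ (α′ , β′) = α - α′ , β - β′

combination-⊖ : ∀ a d f g → combination a d (f ⊖ g) ≡ combination a d f - combination a d g
combination-⊖ a d (α , β) (α′ , β′) = regroup α β α′ β′ a d
  where
  regroup : ∀ α β α′ β′ a d → (α - α′) * a + (β - β′) * d ≡ (α * a + β * d) - (α′ * a + β′ * d)
  regroup = solve-∀

data Regime : Set where
  wide narrow : Regime

-- Coordinates of α a + β d in unknowns u, v > 0 with (a , d) = (u , 3u + v) when 3a < d
-- (wide) and (a , d) = (u + v , 3u + 2v) when 2a < d < 3a (narrow).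
uv : Regime → ℤ × ℤ → ℤ × ℤ
uv wide   (α , β) = α + ℤ.+ 3 * β , β
uv narrow (α , β) = α + ℤ.+ 3 * β , α + ℤ.+ 2 * β

Positive NonNegative : ℤ × ℤ → Set
Positive    (x , y) = (0ℤ < x × 0ℤ ≤ y) ⊎ (0ℤ ≤ x × 0ℤ < y)
NonNegative (x , y) = 0ℤ ≤ x × 0ℤ ≤ y

record Unknowns (r : Regime) (a d : ℤ) : Set where
  field
    u v   : ℤ
    0<u   : 0ℤ < u
    0<v   : 0ℤ < v
    in-uv : ∀ f → combination a d f ≡ combination u v (uv r f)

  private
    scaled-≤ : ∀ {w x} → 0ℤ < w → 0ℤ ≤ x → 0ℤ ≤ x * w
    scaled-≤ {w} 0<w = ℤ.*-monoʳ-≤-nonNeg w {{ℤ.nonNegative (ℤ.<⇒≤ 0<w)}}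
    scaled-< : ∀ {w x} → 0ℤ < w → 0ℤ < x → 0ℤ < x * w
    scaled-< {w} 0<w = ℤ.*-monoʳ-<-pos w {{ℤ.positive 0<w}}

  combination-pos : ∀ f → Positive (uv r f) → 0ℤ < combination a d f
  combination-pos f f>0 rewrite in-uv f with uv r f | f>0
  ... | x , y | inj₁ (0<x , 0≤y) = ℤ.+-mono-<-≤ (scaled-< 0<u 0<x) (scaled-≤ 0<v 0≤y)
  ... | x , y | inj₂ (0≤x , 0<y) = ℤ.+-mono-≤-< (scaled-≤ 0<u 0≤x) (scaled-< 0<v 0<y)

  combination-nonneg : ∀ f → NonNegative (uv r f) → 0ℤ ≤ combination a d f
  combination-nonneg f f≥0 rewrite in-uv f with uv r f | f≥0
  ... | x , y | 0≤x , 0≤y = ℤ.+-mono-≤ (scaled-≤ 0<u 0≤x) (scaled-≤ 0<v 0≤y)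

unknowns-wide : ∀ {a d} → 0ℤ < a → ℤ.+ 3 * a < d → Unknowns wide a d
unknowns-wide {a} {d} 0<a 3a<d = record
  { u = a ; v = d - ℤ.+ 3 * a ; 0<u = 0<a ; 0<v = i<j⇒0<j-i 3a<d
  ; in-uv = λ { (α , β) → regroup α β a d } }
  where
  regroup : ∀ α β a d → α * a + β * d ≡ (α + ℤ.+ 3 * β) * a + β * (d - ℤ.+ 3 * a)
  regroup = solve-∀

unknowns-narrow : ∀ {a d} → ℤ.+ 2 * a < d → d < ℤ.+ 3 * a → Unknowns narrow a d
unknowns-narrow {a} {d} 2a<d d<3a = record
  { u = d - ℤ.+ 2 * a ; v = ℤ.+ 3 * a - d ; 0<u = i<j⇒0<j-i 2a<d ; 0<v = i<j⇒0<j-i d<3a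
  ; in-uv = λ { (α , β) → regroup α β a d } }
  where
  regroup : ∀ α β a d → α * a + β * d ≡
            (α + ℤ.+ 3 * β) * (d - ℤ.+ 2 * a) + (α + ℤ.+ 2 * β) * (ℤ.+ 3 * a - d)
  regroup = solve-∀

headElements : ℤ → ℤ → Vec ℤ 4
headElements a d = 0ℤ ∷ a ∷ ℤ.+ 2 * a ∷ d ∷ []

headSum : ℤ → ℤ → Vec Sign 4 → ℤ
headSum a d p = signedSum p (headElements a d)

coefficients : Vec Sign 4 → ℤ × ℤ
coefficients (_ ∷ s₁ ∷ s₂ ∷ s₃ ∷ []) = signVal s₁ + ℤ.+ 2 * signVal s₂ , signVal s₃

headSum-coefficients : ∀ a d p → headSum a d p ≡ combination a d (coefficients p)
headSum-coefficients a d (s₀ ∷ s₁ ∷ s₂ ∷ s₃ ∷ []) =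
  regroup (signVal s₀) (signVal s₁) (signVal s₂) (signVal s₃) a d
  where
  regroup : ∀ x₀ x₁ x₂ x₃ a d → x₀ * 0ℤ + (x₁ * a + (x₂ * (ℤ.+ 2 * a) + (x₃ * d + 0ℤ))) ≡
                               (x₁ + ℤ.+ 2 * x₂) * a + x₃ * d
  regroup = solve-∀

HeadSum : Parity → ℤ → ℤ → ℤ → Set
HeadSum π a d x = Σ[ p ∈ Vec Sign 4 ] weight p ≡ 3 × headSum a d p ≡ x × HasParity π x

Above : Regime → Vec Sign 4 → Vec Sign 4 → Set
Above r p q = Positive (uv r (coefficients p ⊖ coefficients q))

NearTop : Regime → Vec Sign 4 → Vec Sign 4 → Set
NearTop r top q = NonNegative (uv r (coefficients q ⊖ (coefficients top ⊖ (0ℤ , ℤ.+ 2))))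

Admissible : Parity → Vec Sign 4 → Set
Admissible π p = weight p ≡ 3 × HasParity π (proj₁ (coefficients p) + proj₂ (coefficients p))

-- For concrete patterns this is a statement about small integers, so it is decided by evaluation.
Certificate : Regime → Parity → ℕ → Vec Sign 4 → List (Vec Sign 4) → Set
Certificate r π k top ps = All (Admissible π) (top ∷ ps) × ListLinked.Linked (Above r) (top ∷ ps)
                         × All (NearTop r top) (List.take k (top ∷ ps))

certificate? : ∀ r π k top ps → Dec (Certificate r π k top ps)
certificate? r π k top ps =
  All.all? admissible? (top ∷ ps) ×-dec ListLinked.linked? above? (top ∷ ps)
  ×-dec All.all? nearTop? (List.take k (top ∷ ps))
  where
  admissible? : ∀ p → Dec (Admissible π p)
  admissible? p = weight p ℕ.≟ 3 ×-dec hasParity? π _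
  above? : ∀ p q → Dec (Above r p q)
  above? p q with uv r (coefficients p ⊖ coefficients q)
  ... | x , y = (0ℤ ℤ.<? x ×-dec 0ℤ ℤ.≤? y) ⊎-dec (0ℤ ℤ.≤? x ×-dec 0ℤ ℤ.<? y)
  nearTop? : ∀ q → Dec (NearTop r top q)
  nearTop? q with uv r (coefficients q ⊖ (coefficients top ⊖ (0ℤ , ℤ.+ 2)))
  ... | x , y = 0ℤ ℤ.≤? x ×-dec 0ℤ ℤ.≤? y

module HeadChains {r a d} (unknowns : Unknowns r a d) (a-odd : Even (a - 1ℤ)) (d-odd : Even (d - 1ℤ))
         (0<d : 0ℤ < d) where
  open Unknowns unknowns

  headSum-< : ∀ {p q} → Above r p q → headSum a d q < headSum a d p
  headSum-< {p} {q} p>q = subst₂ _<_ (sym (headSum-coefficients a d q)) (sym (headSum-coefficients a d p))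
    (0<i-j⇒j<i (subst (0ℤ <_) (combination-⊖ a d (coefficients p) (coefficients q))
                              (combination-pos (coefficients p ⊖ coefficients q) p>q)))

  headSum-nearTop : ∀ {top q} → NearTop r top q → headSum a d top - (d + d) ≤ headSum a d q
  headSum-nearTop {top} {q} near = subst₂ _≤_ threshold (sym (headSum-coefficients a d q))
    (ℤ.0≤i-j⇒j≤i (subst (0ℤ ≤_) (combination-⊖ a d (coefficients q) _) (combination-nonneg _ near)))
    where
    twice : ∀ a d → 0ℤ * a + ℤ.+ 2 * d ≡ d + d
    twice = solve-∀
    threshold : combination a d (coefficients top ⊖ (0ℤ , ℤ.+ 2)) ≡ headSum a d top - (d + d)
    threshold = trans (combination-⊖ a d (coefficients top) (0ℤ , ℤ.+ 2))
                      (cong₂ _-_ (sym (headSum-coefficients a d top)) (twice a d))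

  admissible⇒HeadSum : ∀ {π p} → Admissible π p → HeadSum π a d (headSum a d p)
  admissible⇒HeadSum {π} {p} (weight≡3 , parity) =
    p , weight≡3 , refl ,
    subst (HasParity π) (sym (headSum-coefficients a d p))
          (combination-parity a-odd d-odd π (proj₁ (coefficients p)) (proj₂ (coefficients p)) parity)

  headChain : ∀ π k {top ps} → Certificate r π k top ps → ∀ {m} (cs : Vec ℤ m) → Linked _<_ (d ∷ cs) →
              Distinct (Reachable (HeadSum π a d) cs)
                       (length (top ∷ ps) ℕ.+ m ℕ.* length (List.take k (top ∷ ps)) ℕ.+ m C 2)
  headChain π k {top} {ps} (admissible , descending , near) {m} cs linked =
    subst (Distinct _) size (Distinct-weaken proj₁ (chain cs linked))
    where
    open TailExtension (HeadSum π a d) (ℤ.<⇒≤ 0<d)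
           (ListLinked.Linked⇒AllPairs (λ x>y y>z → ℤ.<-trans y>z x>y)
              (ListLinked.map⁺ (ListLinked.map (λ {p} {q} → headSum-< {p} {q}) descending)))
           (All.map⁺ (All.map (λ {p} → admissible⇒HeadSum {π} {p}) admissible))
           k (subst (All _) (sym (take-map k (top ∷ ps)))
                    (All.map⁺ (All.map (λ {q} → headSum-nearTop {top} {q}) near)))
    size : length (map (headSum a d) (top ∷ ps)) ℕ.+ m ℕ.* length (List.take k (map (headSum a d) (top ∷ ps)))
             ℕ.+ m C 2 ≡
           length (top ∷ ps) ℕ.+ m ℕ.* length (List.take k (top ∷ ps)) ℕ.+ m C 2
    size = cong₂ (λ s t → s ℕ.+ m ℕ.* t ℕ.+ m C 2) (length-map _ (top ∷ ps))
                 (trans (cong length (take-map k (top ∷ ps))) (length-map _ (List.take k (top ∷ ps))))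

reachable⇒∈sumset : ∀ {π a d m} {cs : Vec ℤ m} {y} → Reachable (HeadSum π a d) cs y →
                    y ∈ restrictedSignedSumset (3 ℕ.+ m) (headElements a d ++ cs)
reachable⇒∈sumset {a = a} {d} {cs = cs} (x , t , (p , weight≡3 , p·head≡x , _) , t∈ , y≡x+t) =
  let v , weight≡m , v·cs≡t = fullSigned⇒signedSum t∈ in
  subst (_∈ _)
        (trans (signedSum-++ p v (headElements a d) cs) (trans (cong₂ _+_ p·head≡x v·cs≡t) (sym y≡x+t)))
        (∈-restrictedSignedSumset (p ++ v) (trans (weight-++ p v) (cong₂ ℕ._+_ weight≡3 weight≡m)))

parity-separates : ∀ {P Q : ℤ → Set} {m} {cs : Vec ℤ m} {y y′} →
                   (∀ {x} → P x → Even x) → (∀ {x} → Q x → ¬ Even x) →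
                   Reachable P cs y → Reachable Q cs y′ → y ≢ y′
parity-separates {cs = cs} P⇒even Q⇒odd (x , t , px , t∈ , y≡x+t) (x′ , t′ , qx′ , t′∈ , y′≡x′+t′) y≡y′ =
  Q⇒odd qx′ (subst Even (sym x′≡) (Signed.∣m∣n⇒∣m+n (P⇒even px) t-t′-even))
  where
  regroup : ∀ s t t′ → (s - t′) - (s - t) ≡ t - t′
  regroup = solve-∀
  t-t′-even : Even (t - t′)
  t-t′-even = subst Even (regroup (total cs) t t′)
                (Signed.∣m∣n⇒∣m-n (fullSigned-parity t′∈) (fullSigned-parity t∈))
  x′≡ : x′ ≡ x + (t - t′)
  x′≡ = begin
    x′             ≡⟨ solve (x′ List.∷ t′ List.∷ List.[]) ⟩
    (x′ + t′) - t′ ≡⟨ cong (_- t′) (trans (sym y′≡x′+t′) (trans (sym y≡y′) y≡x+t)) ⟩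
    (x + t) - t′   ≡⟨ ℤ.+-assoc x t (- t′) ⟩
    x + (t - t′)   ∎
    where open ≡-Reasoning

even+odd≤sumsetSize : ∀ {a d m} {cs : Vec ℤ m} {n₁ n₂} →
                      Distinct (Reachable (HeadSum even a d) cs) n₁ →
                      Distinct (Reachable (HeadSum odd a d) cs) n₂ →
                      n₁ ℕ.+ n₂ ℕ.≤ restrictedSignedSumsetSize (3 ℕ.+ m) (headElements a d ++ cs)
even+odd≤sumsetSize evens odds =
  subst (ℕ._≤ _) (trans (length-++ E.values) (cong₂ ℕ._+_ E.length≡ O.length≡))
    (Unique⇒length≤sumsetSize unique
      (All.++⁺ (All.map reachable⇒∈sumset E.satisfy) (All.map reachable⇒∈sumset O.satisfy)))
  where
  module E = Distinct evens
  module O = Distinct odds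
  unique : Unique (E.values List.++ O.values)
  unique = AllPairs.++⁺ (AllPairs.map (≢-sym ∘ ℤ.<⇒≢) E.descending)
                        (AllPairs.map (≢-sym ∘ ℤ.<⇒≢) O.descending)
             (All.map (λ e → All.map (parity-separates proj-parity proj-parity e) O.satisfy) E.satisfy)
    where
    proj-parity : ∀ {π a d x} → HeadSum π a d x → HasParity π x
    proj-parity (_ , _ , _ , parity) = parity

mC2+mC2+m≡m*m : ∀ m → m C 2 ℕ.+ m C 2 ℕ.+ m ≡ m ℕ.* m
mC2+mC2+m≡m*m ℕ.zero  = refl
mC2+mC2+m≡m*m (suc m) = begin
  suc m C 2 ℕ.+ suc m C 2 ℕ.+ suc m         ≡⟨ cong (λ X → X ℕ.+ X ℕ.+ suc m) ([1+m]C2≡m+mC2 m) ⟩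
  (m ℕ.+ m C 2) ℕ.+ (m ℕ.+ m C 2) ℕ.+ suc m ≡⟨ regroup m (m C 2) ⟩
  suc (m ℕ.+ m ℕ.+ (m C 2 ℕ.+ m C 2 ℕ.+ m)) ≡⟨ cong (λ X → suc (m ℕ.+ m ℕ.+ X)) (mC2+mC2+m≡m*m m) ⟩
  suc (m ℕ.+ m ℕ.+ m ℕ.* m)                 ≡⟨ square m ⟩
  suc m ℕ.* suc m                           ∎
  where
  open ≡-Reasoning
  regroup : ∀ m X → (m ℕ.+ X) ℕ.+ (m ℕ.+ X) ℕ.+ suc m ≡ suc (m ℕ.+ m ℕ.+ (X ℕ.+ X ℕ.+ m))
  regroup = ℕ-Solver.solve-∀
  square : ∀ m → suc (m ℕ.+ m ℕ.+ m ℕ.* m) ≡ suc m ℕ.* suc m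
  square = ℕ-Solver.solve-∀

count-wide : ∀ m → (8 ℕ.+ m ℕ.* 4 ℕ.+ m C 2) ℕ.+ (6 ℕ.+ m ℕ.* 4 ℕ.+ m C 2) ≡
                   (3 ℕ.+ m) ℕ.* (3 ℕ.+ m) ℕ.+ (3 ℕ.+ m) ℕ.+ 2
count-wide m =
  trans (regroup m (m C 2)) (trans (cong (λ X → X ℕ.+ m ℕ.* 7 ℕ.+ 14) (mC2+mC2+m≡m*m m)) (square m))
  where
  regroup : ∀ m X → (8 ℕ.+ m ℕ.* 4 ℕ.+ X) ℕ.+ (6 ℕ.+ m ℕ.* 4 ℕ.+ X) ≡ (X ℕ.+ X ℕ.+ m) ℕ.+ m ℕ.* 7 ℕ.+ 14
  regroup = ℕ-Solver.solve-∀
  square : ∀ m → m ℕ.* m ℕ.+ m ℕ.* 7 ℕ.+ 14 ≡ (3 ℕ.+ m) ℕ.* (3 ℕ.+ m) ℕ.+ (3 ℕ.+ m) ℕ.+ 2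
  square = ℕ-Solver.solve-∀

count-narrow : ∀ m → (8 ℕ.+ m ℕ.* 4 ℕ.+ m C 2) ℕ.+ (8 ℕ.+ m ℕ.* 5 ℕ.+ m C 2) ≡ (4 ℕ.+ m) ℕ.* (4 ℕ.+ m)
count-narrow m =
  trans (regroup m (m C 2)) (trans (cong (λ X → X ℕ.+ m ℕ.* 8 ℕ.+ 16) (mC2+mC2+m≡m*m m)) (square m))
  where
  regroup : ∀ m X → (8 ℕ.+ m ℕ.* 4 ℕ.+ X) ℕ.+ (8 ℕ.+ m ℕ.* 5 ℕ.+ X) ≡ (X ℕ.+ X ℕ.+ m) ℕ.+ m ℕ.* 8 ℕ.+ 16
  regroup = ℕ-Solver.solve-∀
  square : ∀ m → m ℕ.* m ℕ.+ m ℕ.* 8 ℕ.+ 16 ≡ (4 ℕ.+ m) ℕ.* (4 ℕ.+ m)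
  square = ℕ-Solver.solve-∀

h²+2h∸2≤[1+h]² : ∀ h → h ℕ.* h ℕ.+ 2 ℕ.* h ∸ 2 ℕ.≤ suc h ℕ.* suc h
h²+2h∸2≤[1+h]² h = ℕ.≤-trans (ℕ.m∸n≤m (h ℕ.* h ℕ.+ 2 ℕ.* h) 2)
                              (subst (h ℕ.* h ℕ.+ 2 ℕ.* h ℕ.≤_) (expand h) (ℕ.m≤m+n _ 1))
  where
  expand : ∀ h → h ℕ.* h ℕ.+ 2 ℕ.* h ℕ.+ 1 ≡ suc h ℕ.* suc h
  expand = ℕ-Solver.solve-∀

h²+h+2≤[1+h]² : ∀ h → 1 ℕ.≤ h → h ℕ.* h ℕ.+ h ℕ.+ 2 ℕ.≤ suc h ℕ.* suc h
h²+h+2≤[1+h]² (suc k) _ = subst (suc k ℕ.* suc k ℕ.+ suc k ℕ.+ 2 ℕ.≤_) (expand k) (ℕ.m≤m+n _ k)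
  where
  expand : ∀ k → suc k ℕ.* suc k ℕ.+ suc k ℕ.+ 2 ℕ.+ k ≡ suc (suc k) ℕ.* suc (suc k)
  expand = ℕ-Solver.solve-∀

-- Sign patterns on (0, a₂, 2a₂, a₄); writing a = a₂ and d = a₄, their head sums are, in order,
-- evenTop ∷ evenRest-wide   : 3a+d, a+d, -a+d, -3a+d, 3a-d, a-d, -a-d, -3a-d
-- evenTop ∷ evenRest-narrow : 3a+d, a+d, -a+d, 3a-d, -3a+d, a-d, -a-d, -3a-d
-- oddTop ∷ oddRest-wide     : 2a+d, -2a+d, a, -a, 2a-d, -2a-d
-- oddTop ∷ oddRest-narrow   : 2a+d, 3a, a, -2a+d, 2a-d, -a, -3a, -2a-d
evenTop oddTop : Vec Sign 4
evenTop = zer ∷ pos ∷ pos ∷ pos ∷ []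
oddTop  = pos ∷ zer ∷ pos ∷ pos ∷ []

evenRest-wide oddRest-wide evenRest-narrow oddRest-narrow : List (Vec Sign 4)
evenRest-wide =
  (zer ∷ neg ∷ pos ∷ pos ∷ []) ∷ (zer ∷ pos ∷ neg ∷ pos ∷ []) ∷ (zer ∷ neg ∷ neg ∷ pos ∷ []) ∷
  (zer ∷ pos ∷ pos ∷ neg ∷ []) ∷ (zer ∷ neg ∷ pos ∷ neg ∷ []) ∷ (zer ∷ pos ∷ neg ∷ neg ∷ []) ∷
  (zer ∷ neg ∷ neg ∷ neg ∷ []) ∷ []
evenRest-narrow =
  (zer ∷ neg ∷ pos ∷ pos ∷ []) ∷ (zer ∷ pos ∷ neg ∷ pos ∷ []) ∷ (zer ∷ pos ∷ pos ∷ neg ∷ []) ∷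
  (zer ∷ neg ∷ neg ∷ pos ∷ []) ∷ (zer ∷ neg ∷ pos ∷ neg ∷ []) ∷ (zer ∷ pos ∷ neg ∷ neg ∷ []) ∷
  (zer ∷ neg ∷ neg ∷ neg ∷ []) ∷ []
oddRest-wide =
  (pos ∷ zer ∷ neg ∷ pos ∷ []) ∷ (pos ∷ neg ∷ pos ∷ zer ∷ []) ∷ (pos ∷ pos ∷ neg ∷ zer ∷ []) ∷
  (pos ∷ zer ∷ pos ∷ neg ∷ []) ∷ (pos ∷ zer ∷ neg ∷ neg ∷ []) ∷ []
oddRest-narrow =
  (pos ∷ pos ∷ pos ∷ zer ∷ []) ∷ (pos ∷ neg ∷ pos ∷ zer ∷ []) ∷ (pos ∷ zer ∷ neg ∷ pos ∷ []) ∷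
  (pos ∷ zer ∷ pos ∷ neg ∷ []) ∷ (pos ∷ pos ∷ neg ∷ zer ∷ []) ∷ (pos ∷ neg ∷ neg ∷ zer ∷ []) ∷
  (pos ∷ zer ∷ neg ∷ neg ∷ []) ∷ []

lemma2p12 : (h : ℕ) → 4 ℕ.≤ h →
    (a₂ a₃ a₄ : ℤ) → (rest : Vec ℤ (h ∸ 3)) →
    let A = ℤ.0ℤ ∷ a₂ ∷ a₃ ∷ a₄ ∷ rest in
    Linked ℤ._<_ A →
    ¬ (ℤ.+ 2 ∣ a₂) → a₃ ≡ ℤ.+ 2 ℤ.* a₂ → ¬ (ℤ.+ 2 ∣ a₄) → a₄ ≢ ℤ.+ 3 ℤ.* a₂ →
    (ℤ.+ 3 ℤ.* a₂ ℤ.< a₄ → h ℕ.* h ℕ.+ h ℕ.+ 2 ℕ.≤ restrictedSignedSumsetSize h A)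
    × (a₄ ℤ.< ℤ.+ 3 ℤ.* a₂ → h ℕ.* h ℕ.+ 2 ℕ.* h ∸ 2 ℕ.≤ restrictedSignedSumsetSize h A)
    × (h ℕ.* h ℕ.+ h ℕ.+ 2 ℕ.≤ restrictedSignedSumsetSize h A)
lemma2p12 h (s≤s (s≤s (s≤s (s≤s (z≤n {n}))))) a₂ a₃ a₄ rest (0<a₂ ∷ a₂<a₃ ∷ a₃<a₄ ∷ a₄<rest)
          a₂-odd refl a₄-odd a₄≢3a₂ = wide-bound , narrow-bound , bound
  where
  size : ℕ
  size = restrictedSignedSumsetSize h (headElements a₂ a₄ ++ rest)
  a₂-1-even : Even (a₂ - 1ℤ)
  a₂-1-even = odd⇒pred-even a₂ (a₂-odd ∘ Signed.∣⇒∣ᵤ)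
  a₄-1-even : Even (a₄ - 1ℤ)
  a₄-1-even = odd⇒pred-even a₄ (a₄-odd ∘ Signed.∣⇒∣ᵤ)
  0<a₄ : 0ℤ < a₄
  0<a₄ = ℤ.<-trans 0<a₂ (ℤ.<-trans a₂<a₃ a₃<a₄)

  wide-bound : ℤ.+ 3 * a₂ < a₄ → h ℕ.* h ℕ.+ h ℕ.+ 2 ℕ.≤ size
  wide-bound 3a₂<a₄ = subst (ℕ._≤ size) (count-wide (suc n)) (even+odd≤sumsetSize
      (headChain even 4 (from-yes (certificate? wide even 4 evenTop evenRest-wide)) rest a₄<rest)
      (headChain odd  4 (from-yes (certificate? wide odd  4 oddTop  oddRest-wide)) rest a₄<rest))
    where open HeadChains (unknowns-wide 0<a₂ 3a₂<a₄) a₂-1-even a₄-1-even 0<a₄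

  [1+h]²-bound : a₄ < ℤ.+ 3 * a₂ → suc h ℕ.* suc h ℕ.≤ size
  [1+h]²-bound a₄<3a₂ = subst (ℕ._≤ size) (count-narrow (suc n)) (even+odd≤sumsetSize
      (headChain even 4 (from-yes (certificate? narrow even 4 evenTop evenRest-narrow)) rest a₄<rest)
      (headChain odd  5 (from-yes (certificate? narrow odd  5 oddTop  oddRest-narrow)) rest a₄<rest))
    where open HeadChains (unknowns-narrow a₃<a₄ a₄<3a₂) a₂-1-even a₄-1-even 0<a₄

  narrow-bound : a₄ < ℤ.+ 3 * a₂ → h ℕ.* h ℕ.+ 2 ℕ.* h ∸ 2 ℕ.≤ size
  narrow-bound a₄<3a₂ = ℕ.≤-trans (h²+2h∸2≤[1+h]² h) ([1+h]²-bound a₄<3a₂)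

  bound : h ℕ.* h ℕ.+ h ℕ.+ 2 ℕ.≤ size
  bound with ℤ.<-cmp a₄ (ℤ.+ 3 * a₂)
  ... | tri< a₄<3a₂ _ _ = ℕ.≤-trans (h²+h+2≤[1+h]² h (s≤s z≤n)) ([1+h]²-bound a₄<3a₂)
  ... | tri≈ _ a₄≡3a₂ _ = ⊥-elim (a₄≢3a₂ a₄≡3a₂)
  ... | tri> _ _ 3a₂<a₄ = wide-bound 3a₂<a₄
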